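{- Let $\mathcal{S}$ and $\mathcal{C}$ be the Spitzer and double Spitzer Hopf algebras described in the context, and for each let $D:=S\star N=\pi\circ(S\otimes N)\circ\Delta$ be the Dynkin operator, where $S$ is the antipode, $N$ the grading operator ($N(u)=ku$ for $u$ homogeneous of degree $k$), $\pi$ the product and $\Delta$ the coproduct of the respective Hopf algebra. Then for every $n\ge1$, $$D\big((\rho X)^{[n]}\big)=C^{(n)}(X)\ \text{ in }\mathcal{S},\qquad D\big((\rho X)^{[n-1]}X\big)=c^{(n)}(X)\ \text{ in }\mathcal{C}.$$
   Context: $\mathbb{K}$ is a field of characteristic zero; $T(X)$ is the free associative unital $\mathbb{K}$-algebra on countably many noncommuting variables $x_1,x_2,\dots$; $\mathcal{A}$ is the unital algebra of sequences $(y_1,y_2,\dots)$ of elements of $T(X)$ with componentwise operations; $\rho(y_1,y_2,\dots)=(0,y_1,y_1+y_2,\dots)$ (weight-$1$ Rota–Baxter operator); $X=(x_1,x_2,\dots)$. Set $(\rho X)^{[0]}=1$, $(\rho X)^{[n+1]}=\rho((\rho X)^{[n]}X)$, and $(\rho X)^{[-1]}X:=1$. Spitzer algebra $\mathcal{S}$: unital subalgebra of $\mathcal{A}$ (componentwise product) freely generated by $(\rho X)^{[n]}$, $n\ge1$, of degree $n$, with $\Delta((\rho X)^{[n]})=\sum_{m=0}^n(\rho X)^{[m]}\otimes(\rho X)^{[n-m]}$. Double Spitzer algebra $\mathcal{C}$: algebra for the product $a\ast_\rho b=\rho(a)b+a\rho(b)+ab$ freely generated by $(\rho X)^{[n]}X$,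 $n\ge0$ (unit adjoined), of degree $n+1$, with $\Delta_*((\rho X)^{[n]}X)=\sum_{m=-1}^{n}(\rho X)^{[n-m-1]}X\otimes(\rho X)^{[m]}X$. Define the binary operation $a\bullet_\rho b:=\rho(a)b-b\rho(a)-ba$ on $\mathcal{A}$, $c^{(1)}(a)=a$, $c^{(n)}(a)=c^{(n-1)}(a)\bullet_\rho a$ (left-nested: $(\cdots((a\bullet_\rho a)\bullet_\rho a)\cdots)\bullet_\rho a$ with $n$ factors), and $C^{(n)}(a):=\rho\big(c^{(n)}(a)\big)$. -}

module Defs where

open import Level using (_⊔_) renaming (suc to lsuc)
open import Algebra.Bundles using (CommutativeRing)
open import Data.Nat as ℕ using (ℕ; zero; suc)
open import Data.List using (List; []; _∷_; _++_; map; concatMap; foldr)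
open import Data.List.Properties using (≡-dec)
open import Data.Product using (_×_; _,_; ∃)
open import Relation.Nullary using (¬_; yes; no)
open import Relation.Binary.PropositionalEquality using (_≡_)

record Field c ℓ : Set (lsuc (c ⊔ ℓ)) where
  field
    commutativeRing : CommutativeRing c ℓ
  open CommutativeRing commutativeRing public
  field
    1≉0     : ¬ (1# ≈ 0#)
    inverse : ∀ x → ¬ (x ≈ 0#) → ∃ λ y → (x * y) ≈ 1#

module FieldOps {c ℓ} (F : Field c ℓ) where
  open Field F using (Carrier; 0#; 1#; _+_)
  fromℕ : ℕ → Carrier
  fromℕ zero    = 0#
  fromℕ (suc n) = 1# + fromℕ n

CharZero : ∀ {c ℓ} → Field c ℓ → Set ℓ
CharZero F = ∀ n → fromℕ n ≈ 0# → n ≡ 0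
  where open Field F using (_≈_; 0#)
        open FieldOps F

module Spitzer {c ℓ} (K : Field c ℓ) where
  open Field K using (_≈_; 0#; 1#) renaming (Carrier to 𝕂; _+_ to _+ₖ_; _*_ to _*ₖ_; -_ to -ₖ_)
  open FieldOps K

  -- Words in the noncommuting variables: the variable x_(i+1) is coded by i.
  Word : Set
  Word = List ℕ

  -- T(X): noncommutative polynomials, as finite formal sums of
  -- (coefficient, monomial); equality is equality of all coefficients.
  Poly : Set c
  Poly = List (𝕂 × Word)

  coeff : Poly → Word → 𝕂
  coeff []            w = 0#
  coeff ((a , u) ∷ p) w with ≡-dec ℕ._≟_ u w
  ... | yes _ = a +ₖ coeff p w
  ... | no  _ = coeff p w

  _≈P_ : Poly → Poly → Set ℓ
  p ≈P q = ∀ w → coeff p w ≈ coeff q w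

  0P 1P : Poly
  0P = []
  1P = (1# , []) ∷ []

  var : ℕ → Poly
  var i = (1# , i ∷ []) ∷ []

  _+P_ : Poly → Poly → Poly
  _+P_ = _++_

  scaleP : 𝕂 → Poly → Poly
  scaleP a = map (λ { (b , u) → (a *ₖ b , u) })

  -P_ : Poly → Poly
  -P_ = scaleP (-ₖ 1#)

  _*P_ : Poly → Poly → Poly
  p *P q = concatMap (λ { (a , u) → map (λ { (b , v) → (a *ₖ b , u ++ v) }) q }) p

  -- 𝒜: sequences (y_1, y_2, …) of elements of T(X), indexed from 0 here
  -- (index k stands for the (k+1)-st component), componentwise operations.

  Seq : Set c
  Seq = ℕ → Poly

  _≈A_ : Seq → Seq → Set ℓ
  a ≈A b = ∀ k → a k ≈P b k

  0A 1A : Seq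
  0A _ = 0P
  1A _ = 1P

  _+A_ _·A_ _-A_ : Seq → Seq → Seq
  (a +A b) k = a k +P b k
  (a ·A b) k = a k *P b k
  (a -A b) k = a k +P (-P b k)

  -A_ : Seq → Seq
  (-A a) k = -P a k

  _⊙_ : 𝕂 → Seq → Seq
  (s ⊙ a) k = scaleP s (a k)

  ρ : Seq → Seq
  ρ a zero    = 0P
  ρ a (suc k) = ρ a k +P a k

  X : Seq
  X k = var k

  ρX^ : ℕ → Seq
  ρX^ zero    = 1A
  ρX^ (suc n) = ρ (ρX^ n ·A X)

  -- generators of 𝒞 : (ρX)^[n] X, n ≥ 0
  z : ℕ → Seq
  z n = ρX^ n ·A X

  _∗ρ_ : Seq → Seq → Seq
  a ∗ρ b = ((ρ a ·A b) +A (a ·A ρ b)) +A (a ·A b)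

  _•ρ_ : Seq → Seq → Seq
  a •ρ b = ((ρ a ·A b) -A (b ·A ρ a)) -A (b ·A a)

  -- c^(n)(a), n ≥ 1, coded by c′ a m = c^(m+1)(a)
  c′ : Seq → ℕ → Seq
  c′ a zero    = a
  c′ a (suc m) = c′ a m •ρ a

  c⁽_⁾ : ℕ → Seq → Seq
  c⁽ zero  ⁾ a = 0A     -- unused (n ≥ 1 in the theorem)
  c⁽ suc m ⁾ a = c′ a m

  C⁽_⁾ : ℕ → Seq → Seq
  C⁽ n ⁾ a = ρ (c⁽ n ⁾ a)

  sumA : List Seq → Seq
  sumA = foldr _+A_ 0A

  Σ< : ℕ → (ℕ → Seq) → Seq
  Σ< zero    f = 0A
  Σ< (suc n) f = Σ< n f +A f n

  -- Spitzer Hopf algebra 𝒮 (componentwise product, unit 1A = (ρX)^[0]).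
  -- Δ((ρX)^[n]) = Σ_{m=0}^n (ρX)^[m] ⊗ (ρX)^[n−m]; the antipode S is the
  -- algebra anti-morphism determined on generators by π(S⊗id)Δ = ηε, i.e.
  --   S((ρX)^[0]) = 1,  S((ρX)^[n]) = − Σ_{m=0}^{n-1} S((ρX)^[m]) (ρX)^[n−m]  (n ≥ 1).
  -- antS-upto n m = S((ρX)^[m]) for m ≤ n (computed by course-of-values).
  antS-upto : ℕ → ℕ → Seq
  antS-upto zero    _ = 1A
  antS-upto (suc n) m with m ℕ.≤? n
  ... | yes _ = antS-upto n m
  ... | no  _ = -A Σ< (suc n) (λ j → antS-upto n j ·A ρX^ (suc n ℕ.∸ j))

  antS : ℕ → Seq
  antS n = antS-upto n n

  -- Dynkin operator D = S ⋆ N on the generator (ρX)^[n]: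
  -- D((ρX)^[n]) = Σ_{m=0}^{n} S((ρX)^[m]) · N((ρX)^[n−m]),  N((ρX)^[k]) = k (ρX)^[k].
  DS : ℕ → Seq
  DS n = Σ< (suc n) (λ m → antS m ·A (fromℕ (n ℕ.∸ m) ⊙ ρX^ (n ℕ.∸ m)))

  -- Double Spitzer Hopf algebra 𝒞 (product ∗_ρ, with a formally adjoined
  -- unit 1 = (ρX)^[-1] X).  Δ_*(z_n) = Σ_{m=-1}^{n} z_{n−m−1} ⊗ z_m.
  -- The antipode on generators (z_n, n ≥ 0), from π(S⊗id)Δ_* = ηε:
  --   S(z_n) = − z_n − Σ_{m=0}^{n-1} S(z_{n−m−1}) ∗_ρ z_m
  -- (the term m = n is S(1) ∗ z_n = z_n, the term m = −1 is S(z_n) ∗ 1).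
  antC-upto : ℕ → ℕ → Seq
  antC-upto zero    _ = -A z zero
  antC-upto (suc n) m with m ℕ.≤? n
  ... | yes _ = antC-upto n m
  ... | no  _ = (-A z (suc n)) -A Σ< (suc n) (λ j → antC-upto n (n ℕ.∸ j) ∗ρ z j)

  antC : ℕ → Seq
  antC n = antC-upto n n

  -- D(z_n) = Σ_{m=-1}^{n} S(z_{n−m−1}) ∗_ρ N(z_m),  N(z_m) = (m+1) z_m, N(1) = 0:
  --   = (n+1) z_n + Σ_{m=0}^{n-1} S(z_{n−m−1}) ∗_ρ ((m+1) z_m).
  DC : ℕ → Seq
  DC n = (fromℕ (suc n) ⊙ z n) +A Σ< n (λ m → antC (n ℕ.∸ suc m) ∗ρ (fromℕ (suc m) ⊙ z m))

{-# OPTIONS --safe #-}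
module Submission where

open import Defs
open import Algebra.Bundles using (Ring; CommutativeRing; CommutativeSemigroup)
open import Algebra.Structures using (IsAbelianGroup; IsRing)
import Algebra.Construct.Pointwise as Pointwise
import Algebra.Properties.AbelianGroup as AbelianGroupProperties
import Algebra.Properties.CommutativeSemigroup as CommutativeSemigroupProperties
import Algebra.Properties.Group as GroupProperties
import Algebra.Properties.Ring as RingProperties
import Algebra.Properties.Semiring.Mult as SemiringMultiplication
open import Data.List using (List; []; _∷_; _++_; map; length; take; drop)
import Data.List.Properties as List
open import Data.List.Properties using (≡-dec)
open import Data.Nat using (ℕ; zero; suc; _∸_; _≤_; _<_; _≤′_; ≤′-refl; ≤′-step; s≤s; _≤?_)
open import Data.Nat.Induction using (<-rec)
open import Data.Nat.Properties
  using ( _≟_; ≤-pred; m<n⇒m<1+n; n<1+n; 1+n≰n; ≤⇒≤′; ≤′⇒≤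
        ; m+n∸n≡m; +-∸-assoc; n∸n≡0; m∸[m∸n]≡n; m∸n≤m )
open import Data.Product using (_×_; _,_)
open import Function using (_∘_)
open import Relation.Binary.PropositionalEquality as ≡ using (_≡_; _≢_)
import Relation.Binary.Reasoning.Setoid as SetoidReasoning
open import Relation.Binary.Structures using (IsEquivalence)
open import Relation.Nullary using (yes; no; contradiction)

-- Write g n = (ρX)^[n], c n = c⁽ n ⁾ X and C n = ρ (c n), and let ⋆ be the Cauchy product
-- of ℕ-indexed sequences, (a ⋆ b) n = Σ_{m ≤ n} a m · b (n − m). Then D((ρX)^[n]) = (S ⋆ N g) n,
-- and the recursion defining the antipode says S ⋆ g = δ 1. The heart of the proof is
-- N g = g ⋆ C, by induction on n from the weight-1 Rota–Baxter identity ρ a · ρ b = ρ (a ∗ρ b)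
-- and the recursion c (k+1) = C k X − X C k − X c k; by associativity of ⋆,
-- D g = S ⋆ (g ⋆ C) = (S ⋆ g) ⋆ C = C.
--
-- As ρ turns ∗ρ-products into componentwise products, it maps the antipode and the Dynkin
-- operator of 𝒞 at (ρX)^[n] X to those of 𝒮 at (ρX)^[n+1]. Hence
-- ρ (D((ρX)^[n] X)) = C (n+1) = ρ (c (n+1)), and ρ is injective.

drop-length-++ : ∀ {a} {A : Set a} (u v : List A) → drop (length u) (u ++ v) ≡ v
drop-length-++ []      v = ≡.refl
drop-length-++ (_ ∷ u) v = drop-length-++ u v

take-length-++ : ∀ {a} {A : Set a} (u v : List A) → take (length u) (u ++ v) ≡ u
take-length-++ []      v = ≡.refl
take-length-++ (x ∷ u) v = ≡.cong (x ∷_) (take-length-++ u v)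

take-length-∸-++ : ∀ {a} {A : Set a} (u v : List A) →
                   take (length (u ++ v) ∸ length v) (u ++ v) ≡ u
take-length-∸-++ u v rewrite List.length-++ u {v} | m+n∸n≡m (length u) (length v) =
  take-length-++ u v

diagonal-stable : ∀ {a} {A : Set a} (F : ℕ → ℕ → A) →
                  (∀ {m n} → m ≤ n → F (suc n) m ≡ F n m) →
                  ∀ {m n} → m ≤ n → F n m ≡ F m m
diagonal-stable F F-stable m≤n = go (≤⇒≤′ m≤n)
  where
  go : ∀ {m n} → m ≤′ n → F n m ≡ F m m
  go ≤′-refl        = ≡.refl
  go (≤′-step m≤′n) = ≡.trans (F-stable (≤′⇒≤ m≤′n)) (go m≤′n)

module Convolution {r ℓ} (R : Ring r ℓ) where
  open Ring R
  open SetoidReasoning setoid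
  open CommutativeSemigroupProperties +-commutativeSemigroup using (interchange)

  ∑< : ℕ → (ℕ → Carrier) → Carrier
  ∑< zero    f = 0#
  ∑< (suc n) f = ∑< n f + f n

  ∑<-cong : ∀ n {f g} → (∀ {j} → j < n → f j ≈ g j) → ∑< n f ≈ ∑< n g
  ∑<-cong zero    f≈g = refl
  ∑<-cong (suc n) f≈g = +-cong (∑<-cong n (f≈g ∘ m<n⇒m<1+n)) (f≈g (n<1+n n))

  ∑<-zero : ∀ n {f} → (∀ {j} → j < n → f j ≈ 0#) → ∑< n f ≈ 0#
  ∑<-zero zero    f≈0 = refl
  ∑<-zero (suc n) f≈0 =
    trans (+-cong (∑<-zero n (f≈0 ∘ m<n⇒m<1+n)) (f≈0 (n<1+n n))) (+-identityˡ 0#)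

  ∑<-distrib-+ : ∀ n f g → ∑< n (λ j → f j + g j) ≈ ∑< n f + ∑< n g
  ∑<-distrib-+ zero    f g = sym (+-identityˡ 0#)
  ∑<-distrib-+ (suc n) f g = trans (+-congʳ (∑<-distrib-+ n f g)) (interchange _ _ _ _)

  *-distribˡ-∑< : ∀ n x f → x * ∑< n f ≈ ∑< n (λ j → x * f j)
  *-distribˡ-∑< zero    x f = zeroʳ x
  *-distribˡ-∑< (suc n) x f = trans (distribˡ x _ _) (+-congʳ (*-distribˡ-∑< n x f))

  *-distribʳ-∑< : ∀ n x f → ∑< n f * x ≈ ∑< n (λ j → f j * x)
  *-distribʳ-∑< zero    x f = zeroˡ x
  *-distribʳ-∑< (suc n) x f = trans (distribʳ x _ _) (+-congʳ (*-distribʳ-∑< n x f))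

  ∑<-sucˡ : ∀ n f → ∑< (suc n) f ≈ f 0 + ∑< n (f ∘ suc)
  ∑<-sucˡ zero    f = trans (+-identityˡ (f 0)) (sym (+-identityʳ (f 0)))
  ∑<-sucˡ (suc n) f = trans (+-congʳ (∑<-sucˡ n f)) (+-assoc _ _ _)

  ∑<-reverse : ∀ n f → ∑< n f ≈ ∑< n (λ j → f (n ∸ suc j))
  ∑<-reverse zero    f = refl
  ∑<-reverse (suc n) f = begin
    ∑< n f + f n                        ≈⟨ +-congʳ (∑<-reverse n f) ⟩
    ∑< n (λ j → f (n ∸ suc j)) + f n    ≈⟨ +-comm _ (f n) ⟩
    f n + ∑< n (λ j → f (n ∸ suc j))    ≈⟨ ∑<-sucˡ n (λ j → f (n ∸ j)) ⟨
    ∑< (suc n) (λ j → f (n ∸ j))        ∎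

  infixl 7 _⋆_
  _⋆_ : (ℕ → Carrier) → (ℕ → Carrier) → ℕ → Carrier
  (a ⋆ b) n = ∑< (suc n) (λ m → a m * b (n ∸ m))

  δ : Carrier → ℕ → Carrier
  δ x zero    = x
  δ x (suc _) = 0#

  ⋆-cong : ∀ {a a′ b b′} → (∀ k → a k ≈ a′ k) → (∀ k → b k ≈ b′ k) →
           ∀ n → (a ⋆ b) n ≈ (a′ ⋆ b′) n
  ⋆-cong a≈a′ b≈b′ n = ∑<-cong (suc n) λ {m} _ → *-cong (a≈a′ m) (b≈b′ (n ∸ m))

  ⋆-sucˡ : ∀ a b n → (a ⋆ b) (suc n) ≈ a 0 * b (suc n) + (a ∘ suc ⋆ b) n
  ⋆-sucˡ a b n = ∑<-sucˡ (suc n) (λ m → a m * b (suc n ∸ m))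

  ⋆-sucʳ : ∀ a b n → (a ⋆ b) (suc n) ≈ (a ⋆ b ∘ suc) n + a (suc n) * b 0
  ⋆-sucʳ a b n = +-cong
    (∑<-cong (suc n) λ m<1+n → *-congˡ (reflexive (≡.cong b (+-∸-assoc 1 (≤-pred m<1+n)))))
    (*-congˡ (reflexive (≡.cong b (n∸n≡0 n))))

  ⋆-sucʳ-0# : ∀ a b n → b 0 ≈ 0# → (a ⋆ b) (suc n) ≈ (a ⋆ b ∘ suc) n
  ⋆-sucʳ-0# a b n b₀≈0 =
    trans (⋆-sucʳ a b n) (trans (+-congˡ (trans (*-congˡ b₀≈0) (zeroʳ _))) (+-identityʳ _))

  ⋆-reverse : ∀ a b n → (a ⋆ b) n ≈ ∑< (suc n) (λ j → a (n ∸ j) * b j)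
  ⋆-reverse a b n = trans (∑<-reverse (suc n) (λ m → a m * b (n ∸ m)))
    (∑<-cong (suc n) λ j<1+n → *-congˡ (reflexive (≡.cong b (m∸[m∸n]≡n (≤-pred j<1+n)))))

  ⋆-reverse-0# : ∀ a b n → b 0 ≈ 0# → (a ⋆ b) n ≈ ∑< n (λ j → a (n ∸ suc j) * b (suc j))
  ⋆-reverse-0# a b n b₀≈0 = trans (⋆-reverse a b n) (trans (∑<-sucˡ n (λ j → a (n ∸ j) * b j))
    (trans (+-congʳ (trans (*-congˡ b₀≈0) (zeroʳ _))) (+-identityˡ _)))

  ⋆-distribˡ : ∀ a a′ b n → ((λ k → a k + a′ k) ⋆ b) n ≈ (a ⋆ b) n + (a′ ⋆ b) n
  ⋆-distribˡ a a′ b n = trans (∑<-cong (suc n) λ {m} _ → distribʳ (b (n ∸ m)) (a m) (a′ m))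
    (∑<-distrib-+ (suc n) (λ m → a m * b (n ∸ m)) (λ m → a′ m * b (n ∸ m)))

  ⋆-distribʳ : ∀ a b b′ n → (a ⋆ (λ k → b k + b′ k)) n ≈ (a ⋆ b) n + (a ⋆ b′) n
  ⋆-distribʳ a b b′ n = trans (∑<-cong (suc n) λ {m} _ → distribˡ (a m) (b (n ∸ m)) (b′ (n ∸ m)))
    (∑<-distrib-+ (suc n) (λ m → a m * b (n ∸ m)) (λ m → a m * b′ (n ∸ m)))

  ⋆-*ˡ : ∀ x a b n → ((λ k → x * a k) ⋆ b) n ≈ x * (a ⋆ b) n
  ⋆-*ˡ x a b n = trans (∑<-cong (suc n) λ {m} _ → *-assoc x (a m) (b (n ∸ m)))
    (sym (*-distribˡ-∑< (suc n) x (λ m → a m * b (n ∸ m))))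

  ⋆-*ʳ : ∀ a b x n → (a ⋆ (λ k → b k * x)) n ≈ (a ⋆ b) n * x
  ⋆-*ʳ a b x n = trans (∑<-cong (suc n) λ {m} _ → sym (*-assoc (a m) (b (n ∸ m)) x))
    (sym (*-distribʳ-∑< (suc n) x (λ m → a m * b (n ∸ m))))

  ⋆-*-middle : ∀ a x b n → (a ⋆ (λ k → x * b k)) n ≈ ((λ k → a k * x) ⋆ b) n
  ⋆-*-middle a x b n = ∑<-cong (suc n) λ {m} _ → sym (*-assoc (a m) x (b (n ∸ m)))

  δ-⋆ : ∀ x b n → (δ x ⋆ b) n ≈ x * b n
  δ-⋆ x b zero    = +-identityˡ _
  δ-⋆ x b (suc n) = trans (⋆-sucˡ (δ x) b n)
    (trans (+-congˡ (∑<-zero (suc n) λ {m} _ → zeroˡ (b (n ∸ m)))) (+-identityʳ _))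

  ⋆-δ : ∀ a x n → (a ⋆ δ x) n ≈ a n * x
  ⋆-δ a x zero    = +-identityˡ _
  ⋆-δ a x (suc n) = trans (⋆-sucʳ a (δ x) n)
    (trans (+-congʳ (∑<-zero (suc n) λ {m} _ → zeroʳ (a m))) (+-identityˡ _))

  ⋆-assoc : ∀ a b d n → ((a ⋆ b) ⋆ d) n ≈ (a ⋆ (b ⋆ d)) n
  ⋆-assoc a b d zero    = +-congˡ (begin
    (0# + a 0 * b 0) * d 0    ≈⟨ *-congʳ (+-identityˡ _) ⟩
    (a 0 * b 0) * d 0         ≈⟨ *-assoc _ _ _ ⟩
    a 0 * (b 0 * d 0)         ≈⟨ *-congˡ (+-identityˡ _) ⟨
    a 0 * (0# + b 0 * d 0)    ∎)
  ⋆-assoc a b d (suc n) = begin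
    ((a ⋆ b) ⋆ d) (suc n)
      ≈⟨ ⋆-sucˡ (a ⋆ b) d n ⟩
    (a ⋆ b) 0 * d (suc n) + ((a ⋆ b) ∘ suc ⋆ d) n
      ≈⟨ +-cong (*-congʳ (+-identityˡ _)) (⋆-cong {b = d} (⋆-sucˡ a b) (λ _ → refl) n) ⟩
    a 0 * b 0 * d (suc n) + ((λ k → a 0 * b (suc k) + (a ∘ suc ⋆ b) k) ⋆ d) n
      ≈⟨ +-cong (*-assoc _ _ _) (⋆-distribˡ (λ k → a 0 * b (suc k)) (a ∘ suc ⋆ b) d n) ⟩
    a 0 * (b 0 * d (suc n)) + (((λ k → a 0 * b (suc k)) ⋆ d) n + ((a ∘ suc ⋆ b) ⋆ d) n)
      ≈⟨ +-congˡ (+-cong (⋆-*ˡ (a 0) (b ∘ suc) d n) (⋆-assoc (a ∘ suc) b d n)) ⟩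
    a 0 * (b 0 * d (suc n)) + (a 0 * (b ∘ suc ⋆ d) n + (a ∘ suc ⋆ (b ⋆ d)) n)
      ≈⟨ +-assoc _ _ _ ⟨
    a 0 * (b 0 * d (suc n)) + a 0 * (b ∘ suc ⋆ d) n + (a ∘ suc ⋆ (b ⋆ d)) n
      ≈⟨ +-congʳ (trans (*-congˡ (⋆-sucˡ b d n)) (distribˡ (a 0) _ _)) ⟨
    a 0 * (b ⋆ d) (suc n) + (a ∘ suc ⋆ (b ⋆ d)) n
      ≈⟨ ⋆-sucˡ a (b ⋆ d) n ⟨
    (a ⋆ (b ⋆ d)) (suc n) ∎

module PolynomialRing {c ℓ} (K : Field c ℓ) where
  open Spitzer K
  open ≡ using (refl; sym; trans; cong; cong₂; subst)
  open Field K using (_≈_; 0#; 1#; commutativeRing)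
    renaming (Carrier to 𝕂; _+_ to _+ₖ_; _*_ to _*ₖ_; -_ to -ₖ_)
  private
    module S = CommutativeRing commutativeRing

  -- A record, unlike _≈P_, lets unification recover p and q from p ≋ q.
  infix 4 _≋_
  record _≋_ (p q : Poly) : Set ℓ where
    constructor coeffwise
    field coeff-≈ : p ≈P q
  open _≋_ public

  ≋-isEquivalence : IsEquivalence _≋_
  ≋-isEquivalence = record
    { refl  = coeffwise λ _ → S.refl
    ; sym   = λ (coeffwise p≈q) → coeffwise λ w → S.sym (p≈q w)
    ; trans = λ (coeffwise p≈q) (coeffwise q≈r) → coeffwise λ w → S.trans (p≈q w) (q≈r w)
    }

  ≡⇒≋ : ∀ {p q} → p ≡ q → p ≋ q
  ≡⇒≋ refl = IsEquivalence.refl ≋-isEquivalence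

  coeff-+P : ∀ p q w → coeff (p +P q) w ≈ coeff p w +ₖ coeff q w
  coeff-+P []            q w = S.sym (S.+-identityˡ _)
  coeff-+P ((a , u) ∷ p) q w with ≡-dec _≟_ u w
  ... | yes _ = S.trans (S.+-congˡ (coeff-+P p q w)) (S.sym (S.+-assoc _ _ _))
  ... | no  _ = coeff-+P p q w

  coeff-scaleP : ∀ s p w → coeff (scaleP s p) w ≈ s *ₖ coeff p w
  coeff-scaleP s []            w = S.sym (S.zeroʳ s)
  coeff-scaleP s ((a , u) ∷ p) w with ≡-dec _≟_ u w
  ... | yes _ = S.trans (S.+-congˡ (coeff-scaleP s p w)) (S.sym (S.distribˡ _ _ _))
  ... | no  _ = coeff-scaleP s p w

  coeff--P : ∀ p w → coeff (-P p) w ≈ -ₖ coeff p w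
  coeff--P p w = S.trans (coeff-scaleP (-ₖ 1#) p w) (RingProperties.-1*x≈-x S.ring _)

  ∷-cong : ∀ {a b u v p q} → a ≈ b → u ≡ v → p ≋ q → (a , u) ∷ p ≋ (b , v) ∷ q
  ∷-cong {a} {b} {u} {p = p} {q} a≈b refl (coeffwise p≈q) = coeffwise go
    where
    go : ∀ w → coeff ((a , u) ∷ p) w ≈ coeff ((b , u) ∷ q) w
    go w with ≡-dec _≟_ u w
    ... | yes _ = S.+-cong a≈b (p≈q w)
    ... | no  _ = p≈q w

  +P-cong : ∀ {p p′ q q′} → p ≋ p′ → q ≋ q′ → p +P q ≋ p′ +P q′
  +P-cong {p} {p′} {q} {q′} (coeffwise p≈p′) (coeffwise q≈q′) = coeffwise λ w →
    S.trans (coeff-+P p q w) (S.trans (S.+-cong (p≈p′ w) (q≈q′ w)) (S.sym (coeff-+P p′ q′ w)))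

  +P-comm : ∀ p q → p +P q ≋ q +P p
  +P-comm p q = coeffwise λ w →
    S.trans (coeff-+P p q w) (S.trans (S.+-comm _ _) (S.sym (coeff-+P q p w)))

  +P-inverseˡ : ∀ p → (-P p) +P p ≋ 0P
  +P-inverseˡ p = coeffwise λ w →
    S.trans (coeff-+P (-P p) p w) (S.trans (S.+-congʳ (coeff--P p w)) (S.-‿inverseˡ _))

  +P-inverseʳ : ∀ p → p +P (-P p) ≋ 0P
  +P-inverseʳ p = coeffwise λ w →
    S.trans (coeff-+P p (-P p) w) (S.trans (S.+-congˡ (coeff--P p w)) (S.-‿inverseʳ _))

  scaleP-cong : ∀ {s t p q} → s ≈ t → p ≋ q → scaleP s p ≋ scaleP t q
  scaleP-cong {s} {t} {p} {q} s≈t (coeffwise p≈q) = coeffwise λ w →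
    S.trans (coeff-scaleP s p w) (S.trans (S.*-cong s≈t (p≈q w)) (S.sym (coeff-scaleP t q w)))

  scaleP-0# : ∀ p → scaleP 0# p ≋ 0P
  scaleP-0# p = coeffwise λ w → S.trans (coeff-scaleP 0# p w) (S.zeroˡ _)

  scaleP-1#+ : ∀ s p → scaleP (1# +ₖ s) p ≋ p +P scaleP s p
  scaleP-1#+ s p = coeffwise λ w → S.trans (coeff-scaleP (1# +ₖ s) p w)
    (S.trans (S.distribʳ _ 1# s) (S.trans (S.+-cong (S.*-identityˡ _) (S.sym (coeff-scaleP s p w)))
    (S.sym (coeff-+P p (scaleP s p) w))))

  +P-isAbelianGroup : IsAbelianGroup _≋_ _+P_ 0P -P_
  +P-isAbelianGroup = record
    { isGroup = record
      { isMonoid = record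
        { isSemigroup = record
          { isMagma = record { isEquivalence = ≋-isEquivalence ; ∙-cong = +P-cong }
          ; assoc   = λ p q r → ≡⇒≋ (List.++-assoc p q r)
          }
        ; identity = (λ _ → ≡⇒≋ refl) , (λ p → ≡⇒≋ (List.++-identityʳ p))
        }
      ; inverse = +P-inverseˡ , +P-inverseʳ
      ; ⁻¹-cong = scaleP-cong S.refl
      }
    ; comm = +P-comm
    }

  private
    module +P = IsAbelianGroup +P-isAbelianGroup

    +P-commutativeSemigroup : CommutativeSemigroup c ℓ
    +P-commutativeSemigroup = record { isCommutativeSemigroup = +P.isCommutativeSemigroup }

    open CommutativeSemigroupProperties +P-commutativeSemigroup using (interchange)

  mapWords : (Word → Word) → Poly → Poly
  mapWords φ = map λ (a , u) → a , φ u

  module _ {φ ψ : Word → Word} (ψ∘φ≗id : ∀ u → ψ (φ u) ≡ u) where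

    coeff-mapWords-image : ∀ p u → coeff (mapWords φ p) (φ u) ≈ coeff p u
    coeff-mapWords-image []             u = S.refl
    coeff-mapWords-image ((a , u′) ∷ p) u
      with ≡-dec _≟_ (φ u′) (φ u) | ≡-dec _≟_ u′ u
    ... | yes _      | yes _    = S.+-congˡ (coeff-mapWords-image p u)
    ... | no  _      | no  _    = coeff-mapWords-image p u
    ... | yes φu′≡φu | no u′≢u  =
      contradiction (trans (sym (ψ∘φ≗id u′)) (trans (cong ψ φu′≡φu) (ψ∘φ≗id u))) u′≢u
    ... | no φu′≢φu  | yes u′≡u = contradiction (cong φ u′≡u) φu′≢φu

    coeff-mapWords-outside : ∀ {w} → (∀ u → φ u ≢ w) → ∀ p → coeff (mapWords φ p) w ≈ 0#
    coeff-mapWords-outside {w} w∉φ []            = S.refl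
    coeff-mapWords-outside {w} w∉φ ((a , u) ∷ p) with ≡-dec _≟_ (φ u) w
    ... | yes φu≡w = contradiction φu≡w (w∉φ u)
    ... | no  _    = coeff-mapWords-outside w∉φ p

    -- Thanks to ψ, a word w has a preimage under φ iff φ (ψ w) ≡ w, and then only ψ w.
    mapWords-cong : ∀ {p q} → p ≋ q → mapWords φ p ≋ mapWords φ q
    mapWords-cong {p} {q} (coeffwise p≈q) = coeffwise go
      where
      go : ∀ w → coeff (mapWords φ p) w ≈ coeff (mapWords φ q) w
      go w with ≡-dec _≟_ (φ (ψ w)) w
      ... | yes φψw≡w = subst (λ w → coeff (mapWords φ p) w ≈ coeff (mapWords φ q) w) φψw≡w
        (S.trans (coeff-mapWords-image p (ψ w))
        (S.trans (p≈q (ψ w)) (S.sym (coeff-mapWords-image q (ψ w)))))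
      ... | no  φψw≢w =
        S.trans (coeff-mapWords-outside w∉φ p) (S.sym (coeff-mapWords-outside w∉φ q))
        where
        w∉φ : ∀ u → φ u ≢ w
        w∉φ u φu≡w = φψw≢w (subst (λ v → φ (ψ v) ≡ v) φu≡w (cong φ (ψ∘φ≗id u)))

  mapWords-prefix-cong : ∀ u {p q} → p ≋ q → mapWords (u ++_) p ≋ mapWords (u ++_) q
  mapWords-prefix-cong u = mapWords-cong {ψ = drop (length u)} (drop-length-++ u)

  mapWords-suffix-cong : ∀ v {p q} → p ≋ q → mapWords (_++ v) p ≋ mapWords (_++ v) q
  mapWords-suffix-cong v =
    mapWords-cong {ψ = λ w → take (length w ∸ length v) w} (λ u → take-length-∸-++ u v)

  monomial : 𝕂 → Word → Poly
  monomial a u = (a , u) ∷ []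

  *P-∷ : ∀ a u p q → ((a , u) ∷ p) *P q ≡ (monomial a u *P q) +P (p *P q)
  *P-∷ a u p q = cong (_+P (p *P q)) (sym (List.++-identityʳ _))

  *P-zeroʳ : ∀ p → p *P 0P ≡ 0P
  *P-zeroʳ []      = refl
  *P-zeroʳ (_ ∷ p) = *P-zeroʳ p

  *P-distribʳ : ∀ q p p′ → (p +P p′) *P q ≡ (p *P q) +P (p′ *P q)
  *P-distribʳ q []      p′ = refl
  *P-distribʳ q (_ ∷ p) p′ =
    trans (cong₂ _+P_ refl (*P-distribʳ q p p′)) (sym (List.++-assoc _ (p *P q) (p′ *P q)))

  monomial-*P : ∀ a u q → monomial a u *P q ≡ scaleP a (mapWords (u ++_) q)
  monomial-*P a u []      = refl
  monomial-*P a u (_ ∷ q) = cong (_ ∷_) (monomial-*P a u q)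

  *P-monomial : ∀ p b v → p *P monomial b v ≋ scaleP b (mapWords (_++ v) p)
  *P-monomial []      b v = +P.refl
  *P-monomial (_ ∷ p) b v = ∷-cong (S.*-comm _ b) refl (*P-monomial p b v)

  monomial-*P-cong : ∀ a u {q q′} → q ≋ q′ → monomial a u *P q ≋ monomial a u *P q′
  monomial-*P-cong a u {q} {q′} q≈q′ = begin
    monomial a u *P q                ≡⟨ monomial-*P a u q ⟩
    scaleP a (mapWords (u ++_) q)    ≈⟨ scaleP-cong S.refl (mapWords-prefix-cong u q≈q′) ⟩
    scaleP a (mapWords (u ++_) q′)   ≡⟨ monomial-*P a u q′ ⟨
    monomial a u *P q′               ∎
    where open SetoidReasoning +P.setoid

  monomial-*P-distribˡ : ∀ a u q r →
                         monomial a u *P (q +P r) ≡ (monomial a u *P q) +P (monomial a u *P r)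
  monomial-*P-distribˡ a u []      r = refl
  monomial-*P-distribˡ a u (_ ∷ q) r = cong (_ ∷_) (monomial-*P-distribˡ a u q r)

  *P-distribˡ : ∀ p q r → p *P (q +P r) ≋ (p *P q) +P (p *P r)
  *P-distribˡ []            q r = +P.refl
  *P-distribˡ ((a , u) ∷ p) q r = begin
    ((a , u) ∷ p) *P (q +P r)
      ≡⟨ *P-∷ a u p (q +P r) ⟩
    (monomial a u *P (q +P r)) +P (p *P (q +P r))
      ≈⟨ +P-cong (≡⇒≋ (monomial-*P-distribˡ a u q r)) (*P-distribˡ p q r) ⟩
    (mq +P mr) +P ((p *P q) +P (p *P r))
      ≈⟨ interchange mq mr (p *P q) (p *P r) ⟩
    (mq +P (p *P q)) +P (mr +P (p *P r))
      ≡⟨ cong₂ _+P_ (*P-∷ a u p q) (*P-∷ a u p r) ⟨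
    (((a , u) ∷ p) *P q) +P (((a , u) ∷ p) *P r)
      ∎
    where
    open SetoidReasoning +P.setoid
    mq mr : Poly
    mq = monomial a u *P q
    mr = monomial a u *P r

  *P-congʳ : ∀ p {q q′} → q ≋ q′ → p *P q ≋ p *P q′
  *P-congʳ []            q≈q′ = +P.refl
  *P-congʳ ((a , u) ∷ p) {q} {q′} q≈q′ = begin
    ((a , u) ∷ p) *P q                  ≡⟨ *P-∷ a u p q ⟩
    (monomial a u *P q) +P (p *P q)     ≈⟨ +P-cong (monomial-*P-cong a u q≈q′) (*P-congʳ p q≈q′) ⟩
    (monomial a u *P q′) +P (p *P q′)   ≡⟨ *P-∷ a u p q′ ⟨
    ((a , u) ∷ p) *P q′                 ∎
    where open SetoidReasoning +P.setoid

  *P-congˡ : ∀ {p p′} q → p ≋ p′ → p *P q ≋ p′ *P q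
  *P-congˡ {p} {p′} []            p≈p′ = ≡⇒≋ (trans (*P-zeroʳ p) (sym (*P-zeroʳ p′)))
  *P-congˡ {p} {p′} ((b , v) ∷ q) p≈p′ = begin
    p *P (monomial b v +P q)
      ≈⟨ *P-distribˡ p (monomial b v) q ⟩
    (p *P monomial b v) +P (p *P q)
      ≈⟨ +P-cong (*P-monomial p b v) (*P-congˡ q p≈p′) ⟩
    scaleP b (mapWords (_++ v) p) +P (p′ *P q)
      ≈⟨ +P.∙-congʳ (scaleP-cong S.refl (mapWords-suffix-cong v p≈p′)) ⟩
    scaleP b (mapWords (_++ v) p′) +P (p′ *P q)
      ≈⟨ +P.∙-congʳ (*P-monomial p′ b v) ⟨
    (p′ *P monomial b v) +P (p′ *P q)
      ≈⟨ *P-distribˡ p′ (monomial b v) q ⟨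
    p′ *P (monomial b v +P q)
      ∎
    where open SetoidReasoning +P.setoid

  monomial-*P-monomial : ∀ a u b v r →
                         monomial a u *P (monomial b v *P r) ≋ monomial (a *ₖ b) (u ++ v) *P r
  monomial-*P-monomial a u b v []            = +P.refl
  monomial-*P-monomial a u b v ((d , w) ∷ r) =
    ∷-cong (S.sym (S.*-assoc a b d)) (sym (List.++-assoc u v w)) (monomial-*P-monomial a u b v r)

  monomial-*P-assoc : ∀ a u q r → (monomial a u *P q) *P r ≋ monomial a u *P (q *P r)
  monomial-*P-assoc a u []            r = +P.refl
  monomial-*P-assoc a u ((b , v) ∷ q) r = begin
    (monomial a u *P ((b , v) ∷ q)) *P r
      ≡⟨ *P-∷ (a *ₖ b) (u ++ v) (monomial a u *P q) r ⟩
    (monomial (a *ₖ b) (u ++ v) *P r) +P ((monomial a u *P q) *P r)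
      ≈⟨ +P-cong (+P.sym (monomial-*P-monomial a u b v r)) (monomial-*P-assoc a u q r) ⟩
    (monomial a u *P (monomial b v *P r)) +P (monomial a u *P (q *P r))
      ≡⟨ monomial-*P-distribˡ a u (monomial b v *P r) (q *P r) ⟨
    monomial a u *P ((monomial b v *P r) +P (q *P r))
      ≡⟨ cong (monomial a u *P_) (*P-∷ b v q r) ⟨
    monomial a u *P (((b , v) ∷ q) *P r)
      ∎
    where open SetoidReasoning +P.setoid

  *P-assoc : ∀ p q r → (p *P q) *P r ≋ p *P (q *P r)
  *P-assoc []            q r = +P.refl
  *P-assoc ((a , u) ∷ p) q r = begin
    (((a , u) ∷ p) *P q) *P r                       ≡⟨ cong (_*P r) (*P-∷ a u p q) ⟩
    ((monomial a u *P q) +P (p *P q)) *P r          ≡⟨ *P-distribʳ r (monomial a u *P q) (p *P q) ⟩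
    ((monomial a u *P q) *P r) +P ((p *P q) *P r)   ≈⟨ +P-cong (monomial-*P-assoc a u q r) (*P-assoc p q r) ⟩
    (monomial a u *P (q *P r)) +P (p *P (q *P r))   ≡⟨ *P-∷ a u p (q *P r) ⟨
    ((a , u) ∷ p) *P (q *P r)                       ∎
    where open SetoidReasoning +P.setoid

  *P-identityˡ : ∀ p → 1P *P p ≋ p
  *P-identityˡ []      = +P.refl
  *P-identityˡ (_ ∷ p) = ∷-cong (S.*-identityˡ _) refl (*P-identityˡ p)

  *P-identityʳ : ∀ p → p *P 1P ≋ p
  *P-identityʳ []            = +P.refl
  *P-identityʳ ((_ , u) ∷ p) = ∷-cong (S.*-identityʳ _) (List.++-identityʳ u) (*P-identityʳ p)

  Poly-isRing : IsRing _≋_ _+P_ _*P_ -P_ 0P 1P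
  Poly-isRing = record
    { +-isAbelianGroup = +P-isAbelianGroup
    ; *-cong           = λ {p} {p′} {q} {q′} p≈p′ q≈q′ →
                           +P.trans (*P-congˡ q p≈p′) (*P-congʳ p′ q≈q′)
    ; *-assoc          = *P-assoc
    ; *-identity       = *P-identityˡ , *P-identityʳ
    ; distrib          = *P-distribˡ , λ r p q → ≡⇒≋ (*P-distribʳ r p q)
    }

  Poly-ring : Ring c ℓ
  Poly-ring = record { isRing = Poly-isRing }

module SequenceRing {c ℓ} (K : Field c ℓ) where
  open Spitzer K
  open FieldOps K using (fromℕ)
  open PolynomialRing K
  private
    module P = Ring Poly-ring
    open CommutativeSemigroupProperties P.+-commutativeSemigroup using (interchange)
    open RingProperties Poly-ring using () renaming (+-cancelˡ to +P-cancelˡ)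

  Seq-ring : Ring c ℓ
  Seq-ring = Pointwise.ring ℕ Poly-ring

  open Ring Seq-ring
  open GroupProperties +-group using (inverseˡ-unique; //-rightDividesˡ)
  open RingProperties Seq-ring using (x+x≈x⇒x≈0)
  open SemiringMultiplication semiring using () renaming (_×_ to _×ₙ_)
  open Convolution Seq-ring using (∑<)

  ρ-cong : ∀ {a b} → a ≈ b → ρ a ≈ ρ b
  ρ-cong a≈b zero    = P.refl
  ρ-cong a≈b (suc k) = P.+-cong (ρ-cong a≈b k) (a≈b k)

  ρ-+ : ∀ a b → ρ (a + b) ≈ ρ a + ρ b
  ρ-+ a b zero    = P.refl
  ρ-+ a b (suc k) = P.trans (P.+-congʳ (ρ-+ a b k)) (interchange (ρ a k) (ρ b k) (a k) (b k))

  ρ-0# : ρ 0# ≈ 0#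
  ρ-0# = x+x≈x⇒x≈0 (ρ 0#) (trans (sym (ρ-+ 0# 0#)) (ρ-cong (+-identityˡ 0#)))

  ρ-neg : ∀ a → ρ (- a) ≈ - ρ a
  ρ-neg a = inverseˡ-unique (ρ (- a)) (ρ a)
    (trans (sym (ρ-+ (- a) a)) (trans (ρ-cong (-‿inverseˡ a)) ρ-0#))

  ρ-× : ∀ n a → ρ (n ×ₙ a) ≈ n ×ₙ ρ a
  ρ-× zero    a = ρ-0#
  ρ-× (suc n) a = trans (ρ-+ a (n ×ₙ a)) (+-congˡ (ρ-× n a))

  ρ-∑< : ∀ n f → ρ (∑< n f) ≈ ∑< n (λ j → ρ (f j))
  ρ-∑< zero    f = ρ-0#
  ρ-∑< (suc n) f = trans (ρ-+ (∑< n f) (f n)) (+-congʳ (ρ-∑< n f))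

  ρ-injective : ∀ {a b} → ρ a ≈ ρ b → a ≈ b
  ρ-injective {a} {b} ρa≈ρb k =
    +P-cancelˡ (ρ a k) (a k) (b k) (P.trans (ρa≈ρb (suc k)) (P.+-congʳ (P.sym (ρa≈ρb k))))

  ρa*ρb≈ρ[a∗ρb] : ∀ a b → ρ a * ρ b ≈ ρ (a ∗ρ b)
  ρa*ρb≈ρ[a∗ρb] a b zero    = P.refl
  ρa*ρb≈ρ[a∗ρb] a b (suc k) =
    P.trans (expand (ρ a k) (a k) (ρ b k) (b k)) (P.+-congʳ (ρa*ρb≈ρ[a∗ρb] a b k))
    where
    open SetoidReasoning P.setoid
    expand : ∀ A x B y → (A P.+ x) P.* (B P.+ y) ≋ A P.* B P.+ ((A P.* y P.+ x P.* B) P.+ x P.* y)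
    expand A x B y = begin
      (A P.+ x) P.* (B P.+ y)
        ≈⟨ P.distribʳ (B P.+ y) A x ⟩
      A P.* (B P.+ y) P.+ x P.* (B P.+ y)
        ≈⟨ P.+-cong (P.distribˡ A B y) (P.distribˡ x B y) ⟩
      (A P.* B P.+ A P.* y) P.+ (x P.* B P.+ x P.* y)
        ≈⟨ P.+-assoc (A P.* B) (A P.* y) (x P.* B P.+ x P.* y) ⟩
      A P.* B P.+ (A P.* y P.+ (x P.* B P.+ x P.* y))
        ≈⟨ P.+-congˡ {A P.* B} (P.+-assoc (A P.* y) (x P.* B) (x P.* y)) ⟨
      A P.* B P.+ ((A P.* y P.+ x P.* B) P.+ x P.* y)
        ∎

  a∗ρb≈ρa*b+a*[ρb+b] : ∀ a b → a ∗ρ b ≈ ρ a * b + a * (ρ b + b)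
  a∗ρb≈ρa*b+a*[ρb+b] a b =
    trans (+-assoc (ρ a * b) (a * ρ b) (a * b)) (+-congˡ (sym (distribˡ a (ρ b) b)))

  a•ρb+b*[ρa+a]≈ρa*b : ∀ a b → a •ρ b + b * (ρ a + a) ≈ ρ a * b
  a•ρb+b*[ρa+a]≈ρa*b a b = begin
    A - B - C + b * (ρ a + a)    ≈⟨ +-congˡ {A - B - C} (trans (distribˡ b (ρ a) a) (+-comm B C)) ⟩
    A - B - C + (C + B)          ≈⟨ +-assoc (A - B - C) C B ⟨
    A - B - C + C + B            ≈⟨ +-congʳ {B} (//-rightDividesˡ C (A - B)) ⟩
    A - B + B                    ≈⟨ //-rightDividesˡ B A ⟩
    A                            ∎
    where
    open SetoidReasoning setoid
    A B C : Seq
    A = ρ a * b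
    B = b * ρ a
    C = b * a

  fromℕ-⊙ : ∀ n a → fromℕ n ⊙ a ≈ n ×ₙ a
  fromℕ-⊙ zero    a k = scaleP-0# (a k)
  fromℕ-⊙ (suc n) a k = P.trans (scaleP-1#+ (fromℕ n) (a k)) (P.+-congˡ (fromℕ-⊙ n a k))

  ρ-fromℕ-⊙ : ∀ n a → ρ (fromℕ n ⊙ a) ≈ fromℕ n ⊙ ρ a
  ρ-fromℕ-⊙ n a = trans (ρ-cong (fromℕ-⊙ n a)) (trans (ρ-× n a) (sym (fromℕ-⊙ n (ρ a))))

module Dynkin {c ℓ} (K : Field c ℓ) where
  open Spitzer K
  open FieldOps K using (fromℕ)
  open SequenceRing K
  open Ring Seq-ring
  open Convolution Seq-ring
  open SemiringMultiplication semiring using (×-assoc-*) renaming (_×_ to _×ₙ_)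
  open AbelianGroupProperties +-abelianGroup using (⁻¹-∙-comm)
  open SetoidReasoning setoid

  Σ<≡∑< : ∀ n f → Σ< n f ≡ ∑< n f
  Σ<≡∑< zero    f = ≡.refl
  Σ<≡∑< (suc n) f = ≡.cong (_+A f n) (Σ<≡∑< n f)

  cX CX NρX^ : ℕ → Seq
  cX n   = c⁽ n ⁾ X
  CX n   = C⁽ n ⁾ X
  NρX^ n = fromℕ n ⊙ ρX^ n

  antS-upto-suc : ∀ {m n} → m ≤ n → antS-upto (suc n) m ≡ antS-upto n m
  antS-upto-suc {m} {n} m≤n with m ≤? n
  ... | yes _   = ≡.refl
  ... | no  m≰n = contradiction m≤n m≰n

  antS-suc-≡ : ∀ n → antS (suc n) ≡ -A Σ< (suc n) (λ j → antS-upto n j ·A ρX^ (suc n ∸ j))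
  antS-suc-≡ n with suc n ≤? n
  ... | yes 1+n≤n = contradiction 1+n≤n 1+n≰n
  ... | no  _     = ≡.refl

  antS-suc : ∀ n → antS (suc n) ≈ - (antS ⋆ ρX^ ∘ suc) n
  antS-suc n = begin
    antS (suc n)                                            ≡⟨ antS-suc-≡ n ⟩
    - Σ< (suc n) (λ j → antS-upto n j * ρX^ (suc n ∸ j))     ≡⟨ ≡.cong -_ (Σ<≡∑< (suc n) _) ⟩
    - ∑< (suc n) (λ j → antS-upto n j * ρX^ (suc n ∸ j))     ≈⟨ -‿cong (∑<-cong (suc n) summand) ⟩
    - (antS ⋆ ρX^ ∘ suc) n                                   ∎
    where
    summand : ∀ {j} → j < suc n → antS-upto n j * ρX^ (suc n ∸ j) ≈ antS j * ρX^ (suc (n ∸ j))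
    summand j<1+n = *-cong (reflexive (diagonal-stable antS-upto antS-upto-suc (≤-pred j<1+n)))
                           (reflexive (≡.cong ρX^ (+-∸-assoc 1 (≤-pred j<1+n))))

  antS⋆ρX^ : ∀ n → (antS ⋆ ρX^) n ≈ δ 1# n
  antS⋆ρX^ zero    = trans (+-identityˡ (1# * 1#)) (*-identityˡ 1#)
  antS⋆ρX^ (suc n) = begin
    (antS ⋆ ρX^) (suc n)                ≈⟨ ⋆-sucʳ antS ρX^ n ⟩
    S + antS (suc n) * 1#               ≈⟨ +-congˡ {S} (trans (*-identityʳ (antS (suc n))) (antS-suc n)) ⟩
    S - S                               ≈⟨ -‿inverseʳ S ⟩
    0#                                  ∎
    where
    S : Seq
    S = (antS ⋆ ρX^ ∘ suc) n

  -- With the δ term this also covers c⁽ 1 ⁾ X = X, which the •ρ-recursion does not produce.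
  cX-suc : ∀ k → cX (suc k) + X * (CX k + cX k) ≈ δ X k + CX k * X
  cX-suc zero    = +-congˡ {X} (begin
    X * (ρ 0# + 0#)     ≈⟨ *-congˡ {X} (trans (+-identityʳ (ρ 0#)) ρ-0#) ⟩
    X * 0#              ≈⟨ zeroʳ X ⟩
    0#                  ≈⟨ zeroˡ X ⟨
    0# * X              ≈⟨ *-congʳ {X} ρ-0# ⟨
    ρ 0# * X            ∎)
  cX-suc (suc m) = trans (a•ρb+b*[ρa+a]≈ρa*b (c′ X m) X) (sym (+-identityˡ (CX (suc m) * X)))

  ρX^∘suc⋆CX : ∀ n →
               (ρX^ ∘ suc ⋆ CX) n ≈ ρ ((ρX^ ∘ suc ⋆ cX) n + (z ⋆ λ k → CX k + cX k) n)
  ρX^∘suc⋆CX n = begin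
    ∑< (suc n) (λ m → ρ (z m) * ρ (cX (n ∸ m)))
      ≈⟨ ∑<-cong (suc n) (λ {m} _ → ρa*ρb≈ρ[a∗ρb] (z m) (cX (n ∸ m))) ⟩
    ∑< (suc n) (λ m → ρ (z m ∗ρ cX (n ∸ m)))
      ≈⟨ ρ-∑< (suc n) (λ m → z m ∗ρ cX (n ∸ m)) ⟨
    ρ (∑< (suc n) (λ m → z m ∗ρ cX (n ∸ m)))
      ≈⟨ ρ-cong (∑<-cong (suc n) (λ {m} _ → a∗ρb≈ρa*b+a*[ρb+b] (z m) (cX (n ∸ m)))) ⟩
    ρ (∑< (suc n) (λ m → ρX^ (suc m) * cX (n ∸ m) + z m * e (n ∸ m)))
      ≈⟨ ρ-cong (∑<-distrib-+ (suc n) (λ m → ρX^ (suc m) * cX (n ∸ m))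
                                       (λ m → z m * e (n ∸ m))) ⟩
    ρ ((ρX^ ∘ suc ⋆ cX) n + (z ⋆ e) n)
      ∎
    where
    e : ℕ → Seq
    e k = CX k + cX k

  ρX^⋆cX-suc : ∀ n → (ρX^ ⋆ cX) (suc n) + (z ⋆ λ k → CX k + cX k) n ≈ z n + (ρX^ ⋆ CX) n * X
  ρX^⋆cX-suc n = begin
    (ρX^ ⋆ cX) (suc n) + (z ⋆ e) n
      ≈⟨ +-congʳ {(z ⋆ e) n} (⋆-sucʳ-0# ρX^ cX n refl) ⟩
    (ρX^ ⋆ cX ∘ suc) n + (z ⋆ e) n
      ≈⟨ +-congˡ {(ρX^ ⋆ cX ∘ suc) n} (⋆-*-middle ρX^ X e n) ⟨
    (ρX^ ⋆ cX ∘ suc) n + (ρX^ ⋆ (λ k → X * e k)) n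
      ≈⟨ ⋆-distribʳ ρX^ (cX ∘ suc) (λ k → X * e k) n ⟨
    (ρX^ ⋆ (λ k → cX (suc k) + X * e k)) n
      ≈⟨ ⋆-cong {a = ρX^} (λ _ → refl) cX-suc n ⟩
    (ρX^ ⋆ (λ k → δ X k + CX k * X)) n
      ≈⟨ ⋆-distribʳ ρX^ (δ X) (λ k → CX k * X) n ⟩
    (ρX^ ⋆ δ X) n + (ρX^ ⋆ (λ k → CX k * X)) n
      ≈⟨ +-cong (⋆-δ ρX^ X n) (⋆-*ʳ ρX^ CX X n) ⟩
    z n + (ρX^ ⋆ CX) n * X
      ∎
    where
    e : ℕ → Seq
    e k = CX k + cX k

  ρX^⋆CX-suc : ∀ n → (ρX^ ⋆ CX) (suc n) ≈ ρ (z n + (ρX^ ⋆ CX) n * X)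
  ρX^⋆CX-suc n = begin
    (ρX^ ⋆ CX) (suc n)                      ≈⟨ ⋆-sucˡ ρX^ CX n ⟩
    1# * CX (suc n) + (ρX^ ∘ suc ⋆ CX) n    ≈⟨ +-cong (*-identityˡ (CX (suc n))) (ρX^∘suc⋆CX n) ⟩
    ρ (cX (suc n)) + ρ (P + Q)              ≈⟨ ρ-+ (cX (suc n)) (P + Q) ⟨
    ρ (cX (suc n) + (P + Q))                ≈⟨ ρ-cong (+-assoc (cX (suc n)) P Q) ⟨
    ρ (cX (suc n) + P + Q)                  ≈⟨ ρ-cong (+-congʳ {Q} ρX^⋆cX-sucˡ) ⟨
    ρ ((ρX^ ⋆ cX) (suc n) + Q)              ≈⟨ ρ-cong (ρX^⋆cX-suc n) ⟩
    ρ (z n + (ρX^ ⋆ CX) n * X)              ∎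
    where
    P Q : Seq
    P = (ρX^ ∘ suc ⋆ cX) n
    Q = (z ⋆ λ k → CX k + cX k) n
    ρX^⋆cX-sucˡ : (ρX^ ⋆ cX) (suc n) ≈ cX (suc n) + P
    ρX^⋆cX-sucˡ = trans (⋆-sucˡ ρX^ cX n) (+-congʳ {P} (*-identityˡ (cX (suc n))))

  NρX^-0 : NρX^ 0 ≈ 0#
  NρX^-0 = fromℕ-⊙ 0 1#

  NρX^-suc : ∀ n → NρX^ (suc n) ≈ ρ (z n + NρX^ n * X)
  NρX^-suc n = begin
    fromℕ (suc n) ⊙ ρ (z n)         ≈⟨ ρ-fromℕ-⊙ (suc n) (z n) ⟨
    ρ (fromℕ (suc n) ⊙ z n)         ≈⟨ ρ-cong (fromℕ-⊙ (suc n) (z n)) ⟩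
    ρ (z n + n ×ₙ (ρX^ n * X))      ≈⟨ ρ-cong (+-congˡ {z n} (×-assoc-* n (ρX^ n) X)) ⟨
    ρ (z n + (n ×ₙ ρX^ n) * X)      ≈⟨ ρ-cong (+-congˡ {z n} (*-congʳ {X} (fromℕ-⊙ n (ρX^ n)))) ⟨
    ρ (z n + NρX^ n * X)            ∎

  NρX^≈ρX^⋆CX : ∀ n → NρX^ n ≈ (ρX^ ⋆ CX) n
  NρX^≈ρX^⋆CX zero    =
    trans NρX^-0 (sym (trans (+-identityˡ (1# * ρ 0#)) (trans (*-identityˡ (ρ 0#)) ρ-0#)))
  NρX^≈ρX^⋆CX (suc n) = trans (NρX^-suc n)
    (trans (ρ-cong (+-congˡ {z n} (*-congʳ {X} (NρX^≈ρX^⋆CX n)))) (sym (ρX^⋆CX-suc n)))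

  DS≈CX : ∀ n → DS n ≈ CX n
  DS≈CX n = begin
    DS n                          ≡⟨ Σ<≡∑< (suc n) _ ⟩
    (antS ⋆ NρX^) n               ≈⟨ ⋆-cong {a = antS} (λ _ → refl) NρX^≈ρX^⋆CX n ⟩
    (antS ⋆ (ρX^ ⋆ CX)) n         ≈⟨ ⋆-assoc antS ρX^ CX n ⟨
    ((antS ⋆ ρX^) ⋆ CX) n         ≈⟨ ⋆-cong {b = CX} antS⋆ρX^ (λ _ → refl) n ⟩
    (δ 1# ⋆ CX) n                 ≈⟨ δ-⋆ 1# CX n ⟩
    1# * CX n                     ≈⟨ *-identityˡ (CX n) ⟩
    CX n                          ∎

  antC-upto-suc : ∀ {m n} → m ≤ n → antC-upto (suc n) m ≡ antC-upto n m
  antC-upto-suc {m} {n} m≤n with m ≤? n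
  ... | yes _   = ≡.refl
  ... | no  m≰n = contradiction m≤n m≰n

  antC-suc-≡ : ∀ n →
               antC (suc n) ≡ (-A z (suc n)) -A Σ< (suc n) (λ j → antC-upto n (n ∸ j) ∗ρ z j)
  antC-suc-≡ n with suc n ≤? n
  ... | yes 1+n≤n = contradiction 1+n≤n 1+n≰n
  ... | no  _     = ≡.refl

  antC-suc : ∀ n → antC (suc n) ≈ - z (suc n) - ∑< (suc n) (λ j → antC (n ∸ j) ∗ρ z j)
  antC-suc n = begin
    antC (suc n)
      ≡⟨ antC-suc-≡ n ⟩
    - z (suc n) - Σ< (suc n) (λ j → antC-upto n (n ∸ j) ∗ρ z j)
      ≡⟨ ≡.cong (λ t → - z (suc n) - t) (Σ<≡∑< (suc n) _) ⟩
    - z (suc n) - ∑< (suc n) (λ j → antC-upto n (n ∸ j) ∗ρ z j)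
      ≈⟨ +-congˡ { - z (suc n)} (-‿cong (∑<-cong (suc n) λ {j} _ →
           reflexive (≡.cong (_∗ρ z j) (diagonal-stable antC-upto antC-upto-suc (m∸n≤m n j))))) ⟩
    - z (suc n) - ∑< (suc n) (λ j → antC (n ∸ j) ∗ρ z j)
      ∎

  ρ∘antC : ∀ m → ρ (antC m) ≈ antS (suc m)
  ρ∘antC = <-rec (λ m → ρ (antC m) ≈ antS (suc m)) step
    where
    step : ∀ m → (∀ {k} → k < m → ρ (antC k) ≈ antS (suc k)) → ρ (antC m) ≈ antS (suc m)
    step zero    _  = begin
      ρ (- z 0)                   ≈⟨ ρ-neg (z 0) ⟩
      - ρX^ 1                     ≈⟨ -‿cong (trans (+-identityˡ (1# * ρX^ 1)) (*-identityˡ (ρX^ 1))) ⟨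
      - (antS ⋆ ρX^ ∘ suc) 0      ≈⟨ antS-suc 0 ⟨
      antS 1                      ∎
    step (suc n) IH = begin
      ρ (antC (suc n))                  ≈⟨ ρ-cong (antC-suc n) ⟩
      ρ (- z (suc n) - T)               ≈⟨ ρ-+ (- z (suc n)) (- T) ⟩
      ρ (- z (suc n)) + ρ (- T)         ≈⟨ +-cong (ρ-neg (z (suc n))) (ρ-neg T) ⟩
      - ρX^ (suc (suc n)) - ρ T         ≈⟨ +-congˡ { - ρX^ (suc (suc n))} (-‿cong ρT) ⟩
      - ρX^ (suc (suc n)) - U           ≈⟨ ⁻¹-∙-comm (ρX^ (suc (suc n))) U ⟩
      - (ρX^ (suc (suc n)) + U)         ≈⟨ -‿cong (trans (⋆-sucˡ antS (ρX^ ∘ suc) n)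
                                                        (+-congʳ {U} (*-identityˡ (ρX^ (suc (suc n)))))) ⟨
      - (antS ⋆ ρX^ ∘ suc) (suc n)      ≈⟨ antS-suc (suc n) ⟨
      antS (suc (suc n))                ∎
      where
      T U : Seq
      T = ∑< (suc n) (λ j → antC (n ∸ j) ∗ρ z j)
      U = (antS ∘ suc ⋆ ρX^ ∘ suc) n
      ρT : ρ T ≈ U
      ρT = begin
        ρ T
          ≈⟨ ρ-∑< (suc n) (λ j → antC (n ∸ j) ∗ρ z j) ⟩
        ∑< (suc n) (λ j → ρ (antC (n ∸ j) ∗ρ z j))
          ≈⟨ ∑<-cong (suc n) (λ {j} _ → ρa*ρb≈ρ[a∗ρb] (antC (n ∸ j)) (z j)) ⟨
        ∑< (suc n) (λ j → ρ (antC (n ∸ j)) * ρX^ (suc j))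
          ≈⟨ ∑<-cong (suc n) (λ {j} _ → *-congʳ {ρX^ (suc j)} (IH (s≤s (m∸n≤m n j)))) ⟩
        ∑< (suc n) (λ j → antS (suc (n ∸ j)) * ρX^ (suc j))
          ≈⟨ ⋆-reverse (antS ∘ suc) (ρX^ ∘ suc) n ⟨
        U
          ∎

  ρ∘DC : ∀ n → ρ (DC n) ≈ DS (suc n)
  ρ∘DC n = begin
    ρ (DC n)
      ≡⟨ ≡.cong (λ t → ρ (fromℕ (suc n) ⊙ z n + t)) (Σ<≡∑< n F) ⟩
    ρ (fromℕ (suc n) ⊙ z n + ∑< n F)
      ≈⟨ ρ-+ (fromℕ (suc n) ⊙ z n) (∑< n F) ⟩
    ρ (fromℕ (suc n) ⊙ z n) + ρ (∑< n F)
      ≈⟨ +-cong (ρ-fromℕ-⊙ (suc n) (z n)) (ρ-∑< n F) ⟩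
    NρX^ (suc n) + ∑< n (λ j → ρ (F j))
      ≈⟨ +-congˡ {NρX^ (suc n)} (∑<-cong n λ {j} _ → ρF j) ⟩
    NρX^ (suc n) + ∑< n (λ j → antS (suc (n ∸ suc j)) * NρX^ (suc j))
      ≈⟨ +-cong (*-identityˡ (NρX^ (suc n))) (⋆-reverse-0# (antS ∘ suc) NρX^ n NρX^-0) ⟨
    1# * NρX^ (suc n) + (antS ∘ suc ⋆ NρX^) n
      ≈⟨ ⋆-sucˡ antS NρX^ n ⟨
    (antS ⋆ NρX^) (suc n)
      ≡⟨ Σ<≡∑< (suc (suc n)) _ ⟨
    DS (suc n)
      ∎
    where
    F : ℕ → Seq
    F m = antC (n ∸ suc m) ∗ρ (fromℕ (suc m) ⊙ z m)
    ρF : ∀ j → ρ (F j) ≈ antS (suc (n ∸ suc j)) * NρX^ (suc j)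
    ρF j = trans (sym (ρa*ρb≈ρ[a∗ρb] (antC (n ∸ suc j)) (fromℕ (suc j) ⊙ z j)))
                 (*-cong (ρ∘antC (n ∸ suc j)) (ρ-fromℕ-⊙ (suc j) (z j)))

  DC≈cX : ∀ n → DC n ≈ cX (suc n)
  DC≈cX n = ρ-injective (trans (ρ∘DC n) (DS≈CX (suc n)))

mainTheorem8 : ∀ {c ℓ} (K : Field c ℓ) → CharZero K → let open Spitzer K in ∀ (n : ℕ) → 1 ≤ n → (DS n ≈A C⁽ n ⁾ X) × (DC (n Data.Nat.∸ 1) ≈A c⁽ n ⁾ X)
mainTheorem8 K _ (suc n) _ = (λ k → coeff-≈ (DS≈CX (suc n) k)) , (λ k → coeff-≈ (DC≈cX n k))
  where
  open Dynkin K
  open PolynomialRing K using (coeff-≈)
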